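{- Let $Y$ be a Young diagram with row lengths $a_1\ge a_2\ge\cdots\ge a_m\ge 0$. If $\tau^{(2)}(H(Y))=|Y|$, then $Y$ is wide.
   Context: A Young diagram $Y$ is given by integers $a_1\ge a_2\ge \cdots\ge a_m\ge 0$ (the lengths of its rows, left-aligned); its size is $|Y|=\sum_{i=1}^m a_i$. The $j$th column has length $b_j=|\{i: a_i\ge j\}|$ ($1\le j\le a_1$), and the conjugate $Y'$ is the Young diagram with row lengths $b_1\ge b_2\ge\cdots\ge b_{a_1}$. A Young diagram $X$ dominates a Young diagram $Z$ of the same size if $\sum_{i=1}^k a_i(X)\ge \sum_{i=1}^k a_i(Z)$ for every $k\ge 1$, where $a_i(\cdot)$ denotes the $i$th row length and row-length sequences are padded with zeros. $Y$ is wide if for every subset of its rows, the Young diagram $Z$ formed by these rows dominates its conjugate $Z'$. The tripartite 3-uniform hypergraph $H(Y)$ has vertex sides $R=\{r_1,\dots,r_m\}$, $C=\{c_1,\dots,c_{a_1}\}$, $S=\{s_1,\dots,s_{a_1}\}$ and edge set $\bigcup_{i=1}^m\{\{r_i,c_j,s_k\}: 1\le j,k\le a_i\}$. A 2-cover of $H(Y)$ is a set $P$ of pairs, each of the form $\{r,c\}$, $\{r,s\}$ or $\{c,s\}$ with $r\in R,c\in C,s\in S$, such that every edge of $H(Y)$ contains at least one pair of $P$; $\tau^{(2)}(H(Y))$ is the minimum size of a 2-cover of $H(Y)$. -}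

module Defs where

open import Data.Nat using (ℕ; zero; suc; _+_; _≤_; _<_; _≥_; _≤ᵇ_)
open import Data.Bool using (Bool; true; false; T; if_then_else_)
open import Data.Fin using (Fin; toℕ)
open import Data.List using (List; []; _∷_; length; lookup; allFin; filterᵇ; map; take; upTo)
open import Data.Nat.ListAction using (sum)
open import Relation.Binary.PropositionalEquality using (_≡_)
open import Data.List.Relation.Unary.Linked using (Linked)
open import Data.Sum using (_⊎_)
open import Data.Product using (_×_; Σ)

IsYoung : List ℕ → Set
IsYoung a = Linked _≥_ a

size : List ℕ → ℕ
size = sum

width : List ℕ → ℕ
width []      = 0
width (x ∷ _) = x

conjugate : List ℕ → List ℕ
conjugate a = map (λ j → length (filterᵇ (λ x → suc j ≤ᵇ x) a)) (upTo (width a))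

-- X dominates Z: for all k ≥ 1, Σ_{i≤k} aᵢ(X) ≥ Σ_{i≤k} aᵢ(Z) (take pads with zeros)
Dominates : List ℕ → List ℕ → Set
Dominates x z = ∀ k → sum (take k z) ≤ sum (take k x)

subRows : (a : List ℕ) → (Fin (length a) → Bool) → List ℕ
subRows a sel = map (lookup a) (filterᵇ sel (allFin (length a)))

Wide : List ℕ → Set
Wide a = ∀ (sel : Fin (length a) → Bool) → Dominates (subRows a sel) (conjugate (subRows a sel))

sumFin : (n : ℕ) → (Fin n → ℕ) → ℕ
sumFin zero    f = 0
sumFin (suc n) f = f Fin.zero + sumFin n (λ i → f (Fin.suc i))

b2n : Bool → ℕ
b2n true  = 1
b2n false = 0

-- A set of pairs for H(Y): R = Fin m, C = S = Fin a₁.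
-- rc i j : pair {rᵢ, cⱼ} chosen;  rs i k : {rᵢ, sₖ};  cs j k : {cⱼ, sₖ}.
record PairSet (a : List ℕ) : Set where
  field
    rc : Fin (length a) → Fin (width a) → Bool
    rs : Fin (length a) → Fin (width a) → Bool
    cs : Fin (width a) → Fin (width a) → Bool
open PairSet public

pairCount : (a : List ℕ) → PairSet a → ℕ
pairCount a P =
  sumFin (length a) (λ i → sumFin (width a) (λ j → b2n (rc P i j)))
  + sumFin (length a) (λ i → sumFin (width a) (λ k → b2n (rs P i k)))
  + sumFin (width a) (λ j → sumFin (width a) (λ k → b2n (cs P j k)))

-- Edges of H(Y): {rᵢ, cⱼ, sₖ} with j, k ≤ aᵢ (1-indexed), i.e. toℕ j < aᵢ, toℕ k < aᵢ.
Is2Cover : (a : List ℕ) → PairSet a → Set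
Is2Cover a P = ∀ (i : Fin (length a)) (j k : Fin (width a)) →
  toℕ j < lookup a i → toℕ k < lookup a i →
  T (rc P i j) ⊎ T (rs P i k) ⊎ T (cs P j k)

Tau2Is : (a : List ℕ) → ℕ → Set
Tau2Is a t = Σ (PairSet a) (λ P → Is2Cover a P × pairCount a P ≡ t)
             × (∀ P → Is2Cover a P → t ≤ pairCount a P)

-- Suppose a set Z of rows and some k ≥ 1 violate domination: the first k columns of Z
-- hold more cells than its first k rows.  Let l be the k-th row of Z.  A 2-cover of H(Y)
-- is obtained by covering each unselected row i by its aᵢ pairs {rᵢ, cⱼ}, each selected
-- row i by the pairs {rᵢ, cⱼ} with j > k and {rᵢ, sₘ} with m > l, and the remaining
-- edges by the k·l pairs {cⱼ, sₘ} with j ≤ k, m ≤ l.  For descending Z,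
-- Σ_{z∈Z} (z − l)⁺ + k·l is at most the size of the first k rows, which is less than the
-- size of the first k columns, Σ_{z∈Z} min(z, k) = Σ_{z∈Z} (z − (z − k)⁺).  So this cover
-- has fewer than |Y| pairs, contradicting τ⁽²⁾(H(Y)) = |Y|.
module Submission where

open import Defs
open import Data.Bool using (Bool; true; false; T; if_then_else_; _∧_)
open import Data.Bool.Properties using (T-∧)
open import Data.Fin as Fin using (Fin; toℕ)
open import Data.List
  using (List; []; _∷_; length; lookup; allFin; filterᵇ; map; take; applyUpTo; tabulate)
open import Data.List.Properties using (map-∘; map-tabulate; tabulate-lookup; map-upTo)
open import Data.List.Relation.Unary.All using (All; []; _∷_)
open import Data.List.Relation.Unary.AllPairs using (AllPairs; []; _∷_)
import Data.List.Relation.Unary.AllPairs.Properties as AllPairs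
open import Data.List.Relation.Unary.Sorted.TotalOrder.Properties using (lookup-mono-≤)
open import Data.Nat
  using (ℕ; zero; suc; _+_; _*_; _∸_; _⊓_; _≤_; _<_; _≥_; _≤ᵇ_; _<ᵇ_; z≤n; s≤s; _≤?_)
open import Data.Nat.ListAction using (sum)
open import Data.Nat.Properties
open import Algebra.Properties.CommutativeSemigroup +-commutativeSemigroup using (interchange; xy∙z≈xz∙y)
open import Data.Product using (Σ; _×_; _,_)
open import Data.Sum using (_⊎_; inj₁; inj₂)
open import Function using (_∘_; id)
open import Function.Bundles using (Equivalence)
open import Relation.Binary.Properties.TotalOrder ≤-totalOrder using (≥-totalOrder)
open import Relation.Binary.PropositionalEquality
open import Relation.Nullary using (yes; no; contradiction)
open import Relation.Nullary.Decidable using (T?)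

sumFin-mono : ∀ n {f g : Fin n → ℕ} → (∀ i → f i ≤ g i) → sumFin n f ≤ sumFin n g
sumFin-mono zero    f≤g = z≤n
sumFin-mono (suc n) f≤g = +-mono-≤ (f≤g Fin.zero) (sumFin-mono n (f≤g ∘ Fin.suc))

sumFin-+ : ∀ n (f g : Fin n → ℕ) → sumFin n (λ i → f i + g i) ≡ sumFin n f + sumFin n g
sumFin-+ zero    f g = refl
sumFin-+ (suc n) f g =
  trans (cong (f Fin.zero + g Fin.zero +_) (sumFin-+ n (f ∘ Fin.suc) (g ∘ Fin.suc)))
        (interchange (f Fin.zero) (g Fin.zero) _ _)

sumFin-*ˡ : ∀ n c (f : Fin n → ℕ) → sumFin n (λ i → c * f i) ≡ c * sumFin n f
sumFin-*ˡ zero    c f = sym (*-zeroʳ c)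
sumFin-*ˡ (suc n) c f =
  trans (cong (c * f Fin.zero +_) (sumFin-*ˡ n c (f ∘ Fin.suc))) (sym (*-distribˡ-+ c _ _))

sumFin-product : ∀ m n (f : Fin m → ℕ) (g : Fin n → ℕ) →
                 sumFin m (λ i → sumFin n (λ j → f i * g j)) ≡ sumFin m f * sumFin n g
sumFin-product zero    n f g = refl
sumFin-product (suc m) n f g =
  trans (cong₂ _+_ (sumFin-*ˡ n (f Fin.zero) g) (sumFin-product m n (f ∘ Fin.suc) g))
        (sym (*-distribʳ-+ (sumFin n g) (f Fin.zero) _))

sumFin≡sum-tabulate : ∀ n (f : Fin n → ℕ) → sumFin n f ≡ sum (tabulate f)
sumFin≡sum-tabulate zero    f = refl
sumFin≡sum-tabulate (suc n) f = cong (f Fin.zero +_) (sumFin≡sum-tabulate n (f ∘ Fin.suc))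

sum-map-+ : ∀ {A : Set} (f g : A → ℕ) xs →
            sum (map (λ x → f x + g x) xs) ≡ sum (map f xs) + sum (map g xs)
sum-map-+ f g []       = refl
sum-map-+ f g (x ∷ xs) = trans (cong (f x + g x +_) (sum-map-+ f g xs)) (interchange (f x) (g x) _ _)

sum-map-if-filterᵇ : ∀ {A : Set} (q : A → Bool) (f h : A → ℕ) xs →
                     sum (map (λ x → if q x then f x else h x) xs) + sum (map h (filterᵇ q xs))
                     ≡ sum (map h xs) + sum (map f (filterᵇ q xs))
sum-map-if-filterᵇ q f h []       = refl
sum-map-if-filterᵇ q f h (x ∷ xs) with q x
... | true  = trans (interchange (f x) _ (h x) _)
               (trans (cong₂ _+_ (+-comm (f x) (h x)) (sum-map-if-filterᵇ q f h xs))
                      (interchange (h x) (f x) _ _))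
... | false = trans (+-assoc (h x) _ _)
               (trans (cong (h x +_) (sum-map-if-filterᵇ q f h xs)) (sym (+-assoc (h x) _ _)))

applyUpTo-cong : ∀ {A : Set} {f g : ℕ → A} → (∀ i → f i ≡ g i) → ∀ n → applyUpTo f n ≡ applyUpTo g n
applyUpTo-cong f≗g zero    = refl
applyUpTo-cong f≗g (suc n) = cong₂ _∷_ (f≗g 0) (applyUpTo-cong (f≗g ∘ suc) n)

length-filterᵇ-∷ : ∀ {A : Set} (p : A → Bool) x xs →
                   length (filterᵇ p (x ∷ xs)) ≡ b2n (p x) + length (filterᵇ p xs)
length-filterᵇ-∷ p x xs with p x
... | true  = refl
... | false = refl

b2n-∧ : ∀ x y → b2n (x ∧ y) ≡ b2n x * b2n y
b2n-∧ false y = refl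
b2n-∧ true  y = sym (+-identityʳ (b2n y))

-- lo ≤ t < hi, with the test on hi first so that inRange lo 0 t reduces to false
inRange : ℕ → ℕ → ℕ → Bool
inRange lo hi t = (t <ᵇ hi) ∧ (lo <ᵇ suc t)

inRange-complete : ∀ {lo hi t} → lo ≤ t → t < hi → T (inRange lo hi t)
inRange-complete lo≤t t<hi = Equivalence.from T-∧ (<⇒<ᵇ t<hi , <⇒<ᵇ (s≤s lo≤t))

count-inRange : ∀ w lo hi → sumFin w (λ j → b2n (inRange lo hi (toℕ j))) ≤ hi ∸ lo
count-inRange zero    lo       hi       = z≤n
count-inRange (suc w) lo       zero     = count-inRange w lo zero
count-inRange (suc w) zero     (suc hi) = s≤s (count-inRange w zero hi)
count-inRange (suc w) (suc lo) (suc hi) = count-inRange w lo hi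

count-block : ∀ w k l →
  sumFin w (λ j → sumFin w (λ m → b2n (inRange 0 k (toℕ j) ∧ inRange 0 l (toℕ m)))) ≤ k * l
count-block w k l = begin
    sumFin w (λ j → sumFin w (λ m → b2n (inRange 0 k (toℕ j) ∧ inRange 0 l (toℕ m))))
  ≤⟨ sumFin-mono w (λ j → sumFin-mono w (λ m → ≤-reflexive (b2n-∧ (inRange 0 k (toℕ j)) (inRange 0 l (toℕ m))))) ⟩
    sumFin w (λ j → sumFin w (λ m → b2n (inRange 0 k (toℕ j)) * b2n (inRange 0 l (toℕ m))))
  ≡⟨ sumFin-product w w _ _ ⟩
    sumFin w (λ j → b2n (inRange 0 k (toℕ j))) * sumFin w (λ m → b2n (inRange 0 l (toℕ m)))
  ≤⟨ *-mono-≤ (count-inRange w 0 k) (count-inRange w 0 l) ⟩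
    k * l
  ∎
  where open ≤-Reasoning

deficiencyCover : (a : List ℕ) → (Fin (length a) → Bool) → ℕ → ℕ → PairSet a
deficiencyCover a sel k l = record
  { rc = λ i j → inRange (if sel i then k else 0) (lookup a i) (toℕ j)
  ; rs = λ i m → inRange (if sel i then l else lookup a i) (lookup a i) (toℕ m)
  ; cs = λ j m → inRange 0 k (toℕ j) ∧ inRange 0 l (toℕ m)
  }

row-covered : ∀ b k l {x j m} → j < x → m < x →
  T (inRange (if b then k else 0) x j) ⊎ T (inRange (if b then l else x) x m)
  ⊎ T (inRange 0 k j ∧ inRange 0 l m)
row-covered false k l             j<x m<x = inj₁ (inRange-complete z≤n j<x)
row-covered true  k l {j = j} {m} j<x m<x with k ≤? j | l ≤? m
... | yes k≤j | _       = inj₁ (inRange-complete k≤j j<x)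
... | no _    | yes l≤m = inj₂ (inj₁ (inRange-complete l≤m m<x))
... | no k≰j  | no l≰m  = inj₂ (inj₂ (Equivalence.from T-∧
  (inRange-complete z≤n (≰⇒> k≰j) , inRange-complete z≤n (≰⇒> l≰m))))

deficiencyCover-covers : ∀ a sel k l → Is2Cover a (deficiencyCover a sel k l)
deficiencyCover-covers a sel k l i j m = row-covered (sel i) k l

row-count : ∀ w b k l x →
  sumFin w (λ j → b2n (inRange (if b then k else 0) x (toℕ j)))
  + sumFin w (λ m → b2n (inRange (if b then l else x) x (toℕ m)))
  ≤ (if b then (x ∸ k) + (x ∸ l) else x)
row-count w true  k l x = +-mono-≤ (count-inRange w k x) (count-inRange w l x)
row-count w false k l x =
  ≤-trans (+-mono-≤ (count-inRange w 0 x) (count-inRange w x x)) (≤-reflexive (m+[n∸m]≡n ≤-refl))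

deficiencyCover-size : ∀ a sel k l →
  pairCount a (deficiencyCover a sel k l)
  ≤ sumFin (length a) (λ i → if sel i then (lookup a i ∸ k) + (lookup a i ∸ l) else lookup a i) + k * l
deficiencyCover-size a sel k l =
  +-mono-≤ (≤-trans (≤-reflexive (sym (sumFin-+ (length a) _ _)))
                    (sumFin-mono (length a) (λ i → row-count (width a) (sel i) k l (lookup a i))))
           (count-block (width a) k l)

sumFin-rows-split : ∀ a sel (φ : ℕ → ℕ) →
  sumFin (length a) (λ i → if sel i then φ (lookup a i) else lookup a i) + sum (subRows a sel)
  ≡ size a + sum (map φ (subRows a sel))
sumFin-rows-split a sel φ = begin
    sumFin (length a) cost + sum (subRows a sel)
  ≡⟨ cong (_+ sum (subRows a sel)) (trans (sumFin≡sum-tabulate (length a) cost)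
                                          (cong sum (sym (map-tabulate id cost)))) ⟩
    sum (map cost indices) + sum (map (lookup a) (filterᵇ sel indices))
  ≡⟨ sum-map-if-filterᵇ sel (φ ∘ lookup a) (lookup a) indices ⟩
    sum (map (lookup a) indices) + sum (map (φ ∘ lookup a) (filterᵇ sel indices))
  ≡⟨ cong₂ _+_ (cong sum (trans (map-tabulate id (lookup a)) (tabulate-lookup a)))
               (cong sum (map-∘ (filterᵇ sel indices))) ⟩
    size a + sum (map φ (subRows a sel))
  ∎
  where
  open ≡-Reasoning
  indices : List (Fin (length a))
  indices = allFin (length a)
  cost : Fin (length a) → ℕ
  cost i = if sel i then φ (lookup a i) else lookup a i

subRows-descending : ∀ a sel → IsYoung a → AllPairs _≥_ (subRows a sel)
subRows-descending a sel young =
  AllPairs.map⁺ (AllPairs.filter⁺ (T? ∘ sel) (AllPairs.tabulate⁺-< (λ i<j →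
    lookup-mono-≤ ≥-totalOrder young (<⇒≤ i<j))))

-- the k-th row (counting from 0), zero beyond the last row
rowAt : List ℕ → ℕ → ℕ
rowAt []       _       = 0
rowAt (z ∷ _)  zero    = z
rowAt (_ ∷ zs) (suc k) = rowAt zs k

rowAt-≤ : ∀ {x} zs k → All (_≤ x) zs → rowAt zs k ≤ x
rowAt-≤ []       k       []         = z≤n
rowAt-≤ (z ∷ zs) zero    (z≤x ∷ _)  = z≤x
rowAt-≤ (z ∷ zs) (suc k) (_ ∷ zs≤x) = rowAt-≤ zs k zs≤x

sum-map-∸-≡0 : ∀ {x} zs → All (_≤ x) zs → sum (map (_∸ x) zs) ≡ 0
sum-map-∸-≡0 []       []           = refl
sum-map-∸-≡0 (z ∷ zs) (z≤x ∷ zs≤x) = cong₂ _+_ (m≤n⇒m∸n≡0 z≤x) (sum-map-∸-≡0 zs zs≤x)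

excess-over-row : ∀ zs k → AllPairs _≥_ zs →
  sum (map (_∸ rowAt zs k) zs) + suc k * rowAt zs k ≤ sum (take (suc k) zs)
excess-over-row []       k       []           = ≤-reflexive (*-zeroʳ (suc k))
excess-over-row (z ∷ zs) zero    (z≥zs ∷ _)
  rewrite n∸n≡0 z | sum-map-∸-≡0 zs z≥zs = ≤-refl
excess-over-row (z ∷ zs) (suc k) (z≥zs ∷ desc) = begin
    (z ∸ l + sum (map (_∸ l) zs)) + (l + suc k * l)
  ≡⟨ interchange (z ∸ l) _ l _ ⟩
    (z ∸ l + l) + (sum (map (_∸ l) zs) + suc k * l)
  ≡⟨ cong (_+ (sum (map (_∸ l) zs) + suc k * l)) (m∸n+n≡m (rowAt-≤ zs k z≥zs)) ⟩
    z + (sum (map (_∸ l) zs) + suc k * l)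
  ≤⟨ +-monoʳ-≤ z (excess-over-row zs k desc) ⟩
    z + sum (take (suc k) zs)
  ∎
  where
  open ≤-Reasoning
  l : ℕ
  l = rowAt zs k

column : ℕ → List ℕ → ℕ
column j zs = length (filterᵇ (λ x → suc j ≤ᵇ x) zs)

column-entry : ∀ s k z → b2n (suc s ≤ᵇ z) + (z ∸ suc s) ⊓ k ≡ (z ∸ s) ⊓ suc k
column-entry zero    k zero    = refl
column-entry zero    k (suc z) = refl
column-entry (suc s) k zero    = refl
column-entry (suc s) k (suc z) = column-entry s k z

column-step : ∀ s k zs →
  column s zs + sum (map (λ z → (z ∸ suc s) ⊓ k) zs) ≡ sum (map (λ z → (z ∸ s) ⊓ suc k) zs)
column-step s k []       = refl
column-step s k (z ∷ zs) =
  trans (cong (_+ sum (map (λ z → (z ∸ suc s) ⊓ k) (z ∷ zs))) (length-filterᵇ-∷ (suc s ≤ᵇ_) z zs))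
        (trans (interchange (b2n (suc s ≤ᵇ z)) _ _ _)
               (cong₂ _+_ (column-entry s k z) (column-step s k zs)))

columns-from-≤ : ∀ zs s k w →
  sum (take k (applyUpTo (λ j → column (s + j) zs) w)) ≤ sum (map (λ z → (z ∸ s) ⊓ k) zs)
columns-from-≤ zs s zero    w       = z≤n
columns-from-≤ zs s (suc k) zero    = z≤n
columns-from-≤ zs s (suc k) (suc w) = begin
    column (s + 0) zs + sum (take k (applyUpTo (λ j → column (s + suc j) zs) w))
  ≡⟨ cong₂ _+_ (cong (λ t → column t zs) (+-identityʳ s))
               (cong (sum ∘ take k) (applyUpTo-cong (λ j → cong (λ t → column t zs) (+-suc s j)) w)) ⟩
    column s zs + sum (take k (applyUpTo (λ j → column (suc s + j) zs) w))
  ≤⟨ +-monoʳ-≤ (column s zs) (columns-from-≤ zs (suc s) k w) ⟩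
    column s zs + sum (map (λ z → (z ∸ suc s) ⊓ k) zs)
  ≡⟨ column-step s k zs ⟩
    sum (map (λ z → (z ∸ s) ⊓ suc k) zs)
  ∎
  where open ≤-Reasoning

take-conjugate-≤ : ∀ zs k → sum (take k (conjugate zs)) ≤ sum (map (_⊓ k) zs)
take-conjugate-≤ zs k rewrite map-upTo (λ j → column j zs) (width zs) = columns-from-≤ zs 0 k (width zs)

sum-map-∸+⊓ : ∀ k zs → sum (map (_∸ k) zs) + sum (map (_⊓ k) zs) ≡ sum zs
sum-map-∸+⊓ k []       = refl
sum-map-∸+⊓ k (z ∷ zs) = trans (interchange (z ∸ k) _ (z ⊓ k) _) (cong₂ _+_ split (sum-map-∸+⊓ k zs))
  where
  split : z ∸ k + z ⊓ k ≡ z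
  split = trans (+-comm (z ∸ k) (z ⊓ k)) (trans (cong (_+ (z ∸ k)) (⊓-comm z k)) (m⊓n+n∸m≡n k z))

deficient-rows : ∀ zs k → AllPairs _≥_ zs →
  sum (take (suc k) zs) < sum (take (suc k) (conjugate zs)) →
  sum (map (λ z → (z ∸ suc k) + (z ∸ rowAt zs k)) zs) + suc k * rowAt zs k < sum zs
deficient-rows zs k desc deficient = begin-strict
    sum (map (λ z → (z ∸ K) + (z ∸ l)) zs) + K * l
  ≡⟨ cong (_+ K * l) (sum-map-+ (_∸ K) (_∸ l) zs) ⟩
    (sum (map (_∸ K) zs) + sum (map (_∸ l) zs)) + K * l
  ≡⟨ +-assoc (sum (map (_∸ K) zs)) _ _ ⟩
    sum (map (_∸ K) zs) + (sum (map (_∸ l) zs) + K * l)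
  ≤⟨ +-monoʳ-≤ (sum (map (_∸ K) zs)) (excess-over-row zs k desc) ⟩
    sum (map (_∸ K) zs) + sum (take K zs)
  <⟨ +-monoʳ-< (sum (map (_∸ K) zs)) deficient ⟩
    sum (map (_∸ K) zs) + sum (take K (conjugate zs))
  ≤⟨ +-monoʳ-≤ (sum (map (_∸ K) zs)) (take-conjugate-≤ zs K) ⟩
    sum (map (_∸ K) zs) + sum (map (_⊓ K) zs)
  ≡⟨ sum-map-∸+⊓ K zs ⟩
    sum zs
  ∎
  where
  open ≤-Reasoning
  K l : ℕ
  K = suc k
  l = rowAt zs k

cheaper-cover : ∀ a sel k → IsYoung a →
  sum (take (suc k) (subRows a sel)) < sum (take (suc k) (conjugate (subRows a sel))) →
  Σ (PairSet a) (λ P → Is2Cover a P × pairCount a P < size a)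
cheaper-cover a sel k young deficient =
  deficiencyCover a sel K l , deficiencyCover-covers a sel K l , +-cancelʳ-< (sum zs) _ _ smaller
  where
  open ≤-Reasoning
  zs : List ℕ
  zs = subRows a sel
  K l : ℕ
  K = suc k
  l = rowAt zs k
  φ : ℕ → ℕ
  φ z = (z ∸ K) + (z ∸ l)
  rowCost : ℕ
  rowCost = sumFin (length a) (λ i → if sel i then φ (lookup a i) else lookup a i)
  smaller : pairCount a (deficiencyCover a sel K l) + sum zs < size a + sum zs
  smaller = begin-strict
      pairCount a (deficiencyCover a sel K l) + sum zs
    ≤⟨ +-monoˡ-≤ (sum zs) (deficiencyCover-size a sel K l) ⟩
      (rowCost + K * l) + sum zs
    ≡⟨ xy∙z≈xz∙y rowCost (K * l) (sum zs) ⟩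
      (rowCost + sum zs) + K * l
    ≡⟨ cong (_+ K * l) (sumFin-rows-split a sel φ) ⟩
      (size a + sum (map φ zs)) + K * l
    ≡⟨ +-assoc (size a) _ _ ⟩
      size a + (sum (map φ zs) + K * l)
    <⟨ +-monoʳ-< (size a) (deficient-rows zs k (subRows-descending a sel young) deficient) ⟩
      size a + sum zs
    ∎

theorem1p9 : (a : List ℕ) → IsYoung a → Tau2Is a (size a) → Wide a
theorem1p9 _ _ _ _ zero = z≤n
theorem1p9 a young (_ , minimal) sel (suc k)
  with sum (take (suc k) (conjugate (subRows a sel))) ≤? sum (take (suc k) (subRows a sel))
... | yes dominated = dominated
... | no ¬dominated =
  let P , covers , smaller = cheaper-cover a sel k young (≰⇒> ¬dominated)
  in contradiction (minimal P covers) (<⇒≱ smaller)
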